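{- Let $\rho$ be a nonempty Cayley permutation (pattern), and let $\sigma$ be a $\rho$-minimal inversion sequence. Then $|\rho| + \mathbf{mdd}(\rho) \leq |\sigma| \leq |\rho| + 2\,\mathbf{mdd}(\rho)$. In particular, $|\sigma| \leq 3|\rho| - 2$.
   Context: An inversion sequence of length $n$ is an integer sequence $\sigma=(\sigma_1,\dots,\sigma_n)$ with $\sigma_i\in\{0,\dots,i-1\}$ for all $i$; $\mathcal I$ is the set of all inversion sequences. A Cayley permutation is an integer sequence whose set of values is exactly $\{0,\dots,m\}$ for its maximum $m$; $\mathcal P$ is the set of these. For integer sequences $\sigma$ and $\rho$, $\sigma$ contains $\rho$ (written $\rho\preceq\sigma$) if some subsequence of $|\rho|$ entries of $\sigma$ has its values in the same relative order as $\rho$. $|\sigma|$ denotes length and $\mathbf{mdd}(\sigma)=\max_{i}(\sigma_i-i+1)$ (positions indexed from 1). For a nonempty Cayley permutation $\rho$, let $\mathcal{IP}[\rho]=\{\sigma\in\mathcal I\cap\mathcal P : \rho\preceq\sigma\}$; $\sigma$ is a $\rho$-minimal inversion sequence if it is a minimal element of the poset $(\mathcal{IP}[\rho],\preceq)$. -}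

module Defs where

open import Data.Nat using (ℕ; zero; suc; _<_; _≤_)
open import Data.Integer using (ℤ; +_; _-_; _+_) renaming (_⊔_ to _⊔ℤ_)
open import Data.List using (List; []; _∷_; length; lookup)
open import Data.Fin using (Fin; toℕ)
open import Data.Product using (Σ; _×_; ∃)
open import Data.List.Membership.Propositional using (_∈_)
open import Function.Bundles using (_⇔_)
open import Relation.Binary.PropositionalEquality using (_≡_)

-- Sequences are lists of natural numbers; positions are 1-indexed in the paper,
-- i.e. position (toℕ i + 1) for i : Fin (length s).

-- Inversion sequence: σ_i ∈ {0,…,i-1}, i.e. entry at 0-based index k is ≤ k.
IsInversionSeq : List ℕ → Set
IsInversionSeq s = (k : Fin (length s)) → lookup s k ≤ toℕ k

-- Cayley permutation: set of values is exactly {0,…,m}, m the maximum;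
-- equivalently every value below some value occurring in s also occurs.
IsCayley : List ℕ → Set
IsCayley s = (k : Fin (length s)) (v : ℕ) → v ≤ lookup s k → v ∈ s

_≼_ : List ℕ → List ℕ → Set
ρ ≼ σ = Σ (Fin (length ρ) → Fin (length σ)) λ f →
          ((i j : Fin (length ρ)) → toℕ i < toℕ j → toℕ (f i) < toℕ (f j))
        × ((i j : Fin (length ρ)) →
             (lookup ρ i < lookup ρ j ⇔ lookup σ (f i) < lookup σ (f j))
           × (lookup ρ i ≡ lookup ρ j ⇔ lookup σ (f i) ≡ lookup σ (f j)))

InIP : List ℕ → List ℕ → Set
InIP ρ σ = IsInversionSeq σ × IsCayley σ × ρ ≼ σ

IsMinimal : List ℕ → List ℕ → Set
IsMinimal ρ σ = InIP ρ σ × ((τ : List ℕ) → InIP ρ τ → τ ≼ σ → σ ≼ τ)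

-- mdd(σ) = max_i (σ_i - i + 1) with 1-indexed positions i, as an integer.
-- Defined for nonempty lists; helper takes current 1-based position.
mddFrom : ℕ → ℕ → List ℕ → ℤ
mddFrom i x []       = + x - + i + + 1
mddFrom i x (y ∷ ys) = (+ x - + i + + 1) ⊔ℤ mddFrom (suc i) y ys

mdd : (s : List ℕ) → ℤ
mdd []       = + 0   -- unused: ρ is assumed nonempty
mdd (x ∷ xs) = mddFrom 1 x xs

module Submission where

-- Let f embed ρ into σ, positions counted from 0.  Since ρ is Cayley, ρᵢ ≤ σ_{f i} ≤ f i, and f i
-- leaves room for the |ρ| - 1 - i later pattern entries; hence ρᵢ + |ρ| ≤ |σ| + i, the lower bound.
-- Minimality of σ forces every position of σ outside the image of f to carry a repeated value and
-- to be followed by a tight position (σ_q = q): otherwise deleting it (and closing the gap in the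
-- values if its value was unique) gives a smaller element of IP[ρ].  So the last tight position t
-- is some f i₀, and all uncovered positions lie before t.  Each value below σ_t = t either occurs
-- in the pattern, where distinct such values come from distinct values of ρ below ρ_{i₀}, or occurs
-- at two uncovered positions before t; double counting gives |σ| ≤ |ρ| + 2 (ρ_{i₀} - i₀), which is
-- at most |ρ| + 2 mdd(ρ).  Finally ρₖ < |ρ| for a Cayley permutation, so mdd(ρ) ≤ |ρ| - 1.

open import Defs
open import Data.List using (List; []; _∷_; length)
open import Data.Nat using (ℕ)
open import Data.Product using (_×_)
open import Relation.Binary.PropositionalEquality using (_≢_)

module Sequences where

  open import Data.Empty using (⊥; ⊥-elim)
  open import Data.Fin as Fin
    using (Fin; zero; suc; toℕ; fromℕ<; cast; punchIn; punchOut) renaming (_≟_ to _≟ᶠ_)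
  open import Data.Fin.Properties
    using (toℕ-injective; toℕ-fromℕ<; toℕ-cast; cast-involutive; toℕ<n; injective⇒≤; any?; +↔⊎;
           toℕ-inject≤; inject≤-injective; punchInᵢ≢i; punchIn-injective; punchIn-mono-≤;
           punchOut-mono-≤; punchOut-injective)
  open import Data.List using (lookup; tabulate)
  open import Data.List.Properties using (length-tabulate; lookup-tabulate)
  open import Data.List.Membership.Propositional using (_∈_)
  open import Data.List.Membership.Propositional.Properties using (∈-lookup)
  open import Data.List.Relation.Unary.Any using (index)
  open import Data.List.Relation.Unary.Any.Properties using (lookup-index)
  open import Data.Nat
  open import Data.Nat.Properties
  open import Data.Nat.Solver using (module +-*-Solver)
  open import Data.Product using (∃; _,_; proj₁; proj₂)
  open import Data.Sum using (_⊎_; inj₁; inj₂)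
  open import Data.Sum.Function.Propositional using (_⊎-↔_)
  open import Data.Vec.Functional using (Vector; removeAt)
  open import Data.Vec.Functional.Properties using (removeAt-punchOut)
  open import Function using (_∘_; _$_; id)
  open import Function.Bundles using (_⇔_; mk⇔; Equivalence; _↔_; Inverse; Injection)
  open import Function.Definitions using (Injective)
  import Function.Properties.Equivalence as ⇔
  open import Function.Properties.Inverse using (↔-refl; ↔-sym; ↔-trans; ↔⇒↣)
  open import Relation.Binary.Definitions using (tri<; tri≈; tri>)
  open import Relation.Binary.PropositionalEquality
  open import Relation.Nullary using (¬_; Dec; yes; no; contradiction; ¬?)
  open import Relation.Nullary.Decidable using (_×-dec_)
  open import Relation.Unary using (Decidable)

  -- Versions of the list notions of Defs for vectors Fin n → ℕ, where deleting an entry is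
  -- removeAt and relabelling the values is postcomposition.

  Increasing : ∀ {n m} → (Fin n → Fin m) → Set
  Increasing f = ∀ i j → toℕ i < toℕ j → toℕ (f i) < toℕ (f j)

  PreservesOrder : ∀ {n m} → Vector ℕ n → Vector ℕ m → (Fin n → Fin m) → Set
  PreservesOrder a b f = ∀ i j → (a i < a j ⇔ b (f i) < b (f j)) × (a i ≡ a j ⇔ b (f i) ≡ b (f j))

  infix 4 _⊑_
  record _⊑_ {n m} (a : Vector ℕ n) (b : Vector ℕ m) : Set where
    constructor embed
    field
      map        : Fin n → Fin m
      increasing : Increasing map
      preserves  : PreservesOrder a b map

  ≼⇒⊑ : ∀ {ρ σ} → ρ ≼ σ → lookup ρ ⊑ lookup σ
  ≼⇒⊑ (f , inc , ord) = embed f inc ord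

  ⊑⇒≼ : ∀ {ρ σ} → lookup ρ ⊑ lookup σ → ρ ≼ σ
  ⊑⇒≼ (embed f inc ord) = f , inc , ord

  IsInversionᶠ : ∀ {n} → Vector ℕ n → Set
  IsInversionᶠ s = ∀ p → s p ≤ toℕ p

  IsCayleyᶠ : ∀ {n} → Vector ℕ n → Set
  IsCayleyᶠ s = ∀ p v → v ≤ s p → ∃ λ q → s q ≡ v

  Covered : ∀ {n m} → (Fin n → Fin m) → Fin m → Set
  Covered f p = ∃ λ i → f i ≡ p

  IsTight : ∀ {n} → Vector ℕ n → Fin n → Set
  IsTight s p = s p ≡ toℕ p

  module _ {n m} {f : Fin n → Fin m} (inc : Increasing f) where

    increasing⇒monotone : ∀ i j → toℕ i ≤ toℕ j → toℕ (f i) ≤ toℕ (f j)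
    increasing⇒monotone i j i≤j with m≤n⇒m<n∨m≡n i≤j
    ... | inj₁ i<j = <⇒≤ (inc i j i<j)
    ... | inj₂ i≡j = ≤-reflexive (cong (toℕ ∘ f) (toℕ-injective i≡j))

    increasing⇒injective : Injective _≡_ _≡_ f
    increasing⇒injective {i} {j} fi≡fj with <-cmp (toℕ i) (toℕ j)
    ... | tri< i<j _ _ = contradiction (cong toℕ fi≡fj) (<⇒≢ (inc i j i<j))
    ... | tri≈ _ i≡j _ = toℕ-injective i≡j
    ... | tri> _ _ j<i = contradiction (cong toℕ fi≡fj) (>⇒≢ (inc j i j<i))

    increasing-gap : ∀ d i j → toℕ i + d ≡ toℕ j → toℕ (f i) + d ≤ toℕ (f j)
    increasing-gap zero i j i≡j rewrite +-identityʳ (toℕ (f i)) =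
      ≤-reflexive (cong (toℕ ∘ f) (toℕ-injective (trans (sym (+-identityʳ (toℕ i))) i≡j)))
    increasing-gap (suc d) i j i+d+1≡j = begin
      toℕ (f i) + suc d  ≡⟨ +-suc (toℕ (f i)) d ⟩
      suc (toℕ (f i) + d) ≤⟨ s≤s (increasing-gap d i k (sym (toℕ-fromℕ< k<n))) ⟩
      suc (toℕ (f k))     ≤⟨ inc k j k<j ⟩
      toℕ (f j)           ∎
      where
      open ≤-Reasoning
      i+d<j : toℕ i + d < toℕ j
      i+d<j = ≤-reflexive (trans (sym (+-suc (toℕ i) d)) i+d+1≡j)
      k<n : toℕ i + d < n
      k<n = <-trans i+d<j (toℕ<n j)
      k : Fin n
      k = fromℕ< k<n
      k<j : toℕ k < toℕ j
      k<j = subst (_< toℕ j) (sym (toℕ-fromℕ< k<n)) i+d<j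

    increasing-room : ∀ i → toℕ (f i) + n ≤ m + toℕ i
    increasing-room i = begin
      toℕ (f i) + n                    ≡⟨ cong (toℕ (f i) +_) (sym (m+[n∸m]≡n (toℕ<n i))) ⟩
      toℕ (f i) + (suc (toℕ i) + d)    ≡⟨ solve 3 (λ x y z → x :+ (con 1 :+ y :+ z) := (con 1 :+ x :+ z) :+ y)
                                                    refl (toℕ (f i)) (toℕ i) d ⟩
      suc (toℕ (f i) + d) + toℕ i      ≤⟨ +-monoˡ-≤ (toℕ i) (<-≤-trans (s≤s gap) (toℕ<n (f j))) ⟩
      m + toℕ i                        ∎
      where
      open ≤-Reasoning
      open +-*-Solver
      d = n ∸ suc (toℕ i)
      j<n : toℕ i + d < n
      j<n = ≤-reflexive (m+[n∸m]≡n (toℕ<n i))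
      j : Fin n
      j = fromℕ< j<n
      gap : toℕ (f i) + d ≤ toℕ (f j)
      gap = increasing-gap d i j (sym (toℕ-fromℕ< j<n))

  ⊑⇒≤ : ∀ {n m} {a : Vector ℕ n} {b : Vector ℕ m} → a ⊑ b → n ≤ m
  ⊑⇒≤ (embed _ inc _) = injective⇒≤ (increasing⇒injective inc)

  monotone∧injective⇒increasing : ∀ {n m} {g : Fin n → Fin m} →
    (∀ i j → toℕ i ≤ toℕ j → toℕ (g i) ≤ toℕ (g j)) → Injective _≡_ _≡_ g → Increasing g
  monotone∧injective⇒increasing mono inj i j i<j =
    ≤∧≢⇒< (mono i j (<⇒≤ i<j)) (λ gi≡gj → <⇒≢ i<j (cong toℕ (inj (toℕ-injective gi≡gj))))

  ⊑-trans : ∀ {n m l} {a : Vector ℕ n} {b : Vector ℕ m} {c : Vector ℕ l} →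
    a ⊑ b → b ⊑ c → a ⊑ c
  ⊑-trans (embed f f-inc f-ord) (embed g g-inc g-ord) =
    embed (g ∘ f) (λ i j → g-inc (f i) (f j) ∘ f-inc i j) λ i j →
      ⇔.trans (proj₁ (f-ord i j)) (proj₁ (g-ord (f i) (f j))) ,
      ⇔.trans (proj₂ (f-ord i j)) (proj₂ (g-ord (f i) (f j)))

  preservesOrder-refl : ∀ {n} (a : Vector ℕ n) → PreservesOrder a a id
  preservesOrder-refl a i j = ⇔.refl , ⇔.refl

  preservesOrder-sym : ∀ {n} {a b : Vector ℕ n} → PreservesOrder a b id → PreservesOrder b a id
  preservesOrder-sym ord i j = ⇔.sym (proj₁ (ord i j)) , ⇔.sym (proj₂ (ord i j))

  preservesOrder-resp : ∀ {n m l} {a : Vector ℕ n} {b : Vector ℕ m} {b′ : Vector ℕ l} {f g} →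
    (∀ i → b′ (g i) ≡ b (f i)) → PreservesOrder a b f → PreservesOrder a b′ g
  preservesOrder-resp b′g≗bf ord i j rewrite b′g≗bf i | b′g≗bf j = ord i j

  ⊑-reindex : ∀ {n m} {a : Vector ℕ n} {b : Vector ℕ m} (c : Fin n → Fin m) →
    (∀ i → toℕ (c i) ≡ toℕ i) → (∀ i → b (c i) ≡ a i) → a ⊑ b
  ⊑-reindex {a = a} {b} c toℕ-c bc≗a =
    embed c (λ i j i<j → subst₂ _<_ (sym (toℕ-c i)) (sym (toℕ-c j)) i<j)
      (preservesOrder-resp {b = a} {b′ = b} {f = id} {g = c} bc≗a (preservesOrder-refl a))

  preservesOrder-relabel : ∀ {n} {b : Vector ℕ n} (g : ℕ → ℕ) →
    (∀ i j → b i < b j → g (b i) < g (b j)) → PreservesOrder b (g ∘ b) id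
  preservesOrder-relabel {b = b} g mono i j = mk⇔ (mono i j) reflect< , mk⇔ (cong g) reflect≡
    where
    reflect< : g (b i) < g (b j) → b i < b j
    reflect< gi<gj with <-cmp (b i) (b j)
    ... | tri< bi<bj _ _ = bi<bj
    ... | tri≈ _ bi≡bj _ = contradiction (cong g bi≡bj) (<⇒≢ gi<gj)
    ... | tri> _ _ bj<bi = contradiction gi<gj (<⇒≯ (mono j i bj<bi))
    reflect≡ : g (b i) ≡ g (b j) → b i ≡ b j
    reflect≡ gi≡gj with <-cmp (b i) (b j)
    ... | tri< bi<bj _ _ = contradiction gi≡gj (<⇒≢ (mono i j bi<bj))
    ... | tri≈ _ bi≡bj _ = bi≡bj
    ... | tri> _ _ bj<bi = contradiction gi≡gj (>⇒≢ (mono j i bj<bi))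

  removeAt-⊑ : ∀ {m} (s : Vector ℕ (suc m)) k → removeAt s k ⊑ s
  removeAt-⊑ s k =
    embed (punchIn k)
      (monotone∧injective⇒increasing (punchIn-mono-≤ k) (punchIn-injective k _ _))
      (preservesOrder-refl (removeAt s k))

  ⊑-removeAt : ∀ {n m} {a : Vector ℕ n} {s : Vector ℕ (suc m)} {k} (e : a ⊑ s) →
    ¬ Covered (_⊑_.map e) k → a ⊑ removeAt s k
  ⊑-removeAt {s = s} {k} (embed f inc ord) unc =
    embed f′
      (monotone∧injective⇒increasing
        (λ i j i≤j → punchOut-mono-≤ (k≢f i) (k≢f j) (increasing⇒monotone inc i j i≤j))
        (λ eq → increasing⇒injective inc (punchOut-injective (k≢f _) (k≢f _) eq)))
      (preservesOrder-resp {b = s} {b′ = removeAt s k} {f = f} (λ i → removeAt-punchOut s (k≢f i)) ord)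
    where
    k≢f : ∀ i → k ≢ f i
    k≢f i k≡fi = unc (i , sym k≡fi)
    f′ : _ → Fin _
    f′ i = punchOut (k≢f i)

  ⊑-relabel : ∀ {n} {b : Vector ℕ n} (g : ℕ → ℕ) →
    (∀ i j → b i < b j → g (b i) < g (b j)) → b ⊑ g ∘ b
  ⊑-relabel g mono = embed id (λ _ _ i<j → i<j) (preservesOrder-relabel g mono)

  relabel-⊑ : ∀ {n} {b : Vector ℕ n} (g : ℕ → ℕ) →
    (∀ i j → b i < b j → g (b i) < g (b j)) → g ∘ b ⊑ b
  relabel-⊑ g mono = embed id (λ _ _ i<j → i<j) (preservesOrder-sym (preservesOrder-relabel g mono))

  module _ {xs : List ℕ} where

    lookup-cayley : IsCayley xs → IsCayleyᶠ (lookup xs)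
    lookup-cayley cay p v v≤xsₚ = index v∈xs , sym (lookup-index v∈xs)
      where v∈xs = cay p v v≤xsₚ

  module _ {m} (h : Vector ℕ m) where

    private
      length-h : length (tabulate h) ≡ m
      length-h = length-tabulate h

    lookup-tabulate′ : ∀ i → lookup (tabulate h) i ≡ h (cast length-h i)
    lookup-tabulate′ i = begin
      lookup (tabulate h) i
        ≡⟨ cong (lookup (tabulate h)) (cast-involutive (sym length-h) length-h i) ⟨
      lookup (tabulate h) (cast (sym length-h) (cast length-h i))
        ≡⟨ lookup-tabulate h (cast length-h i) ⟩
      h (cast length-h i)
        ∎
      where open ≡-Reasoning

    tabulate-inversion : IsInversionᶠ h → IsInversionSeq (tabulate h)
    tabulate-inversion inv k =
      subst₂ _≤_ (sym (lookup-tabulate′ k)) (toℕ-cast length-h k) (inv (cast length-h k))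

    tabulate-cayley : IsCayleyᶠ h → IsCayley (tabulate h)
    tabulate-cayley cay k v v≤ with cay (cast length-h k) v (subst (v ≤_) (lookup-tabulate′ k) v≤)
    ... | q , hq≡v =
      subst (_∈ tabulate h) (trans (lookup-tabulate h q) hq≡v) (∈-lookup (cast (sym length-h) q))

    ⊑-tabulate : h ⊑ lookup (tabulate h)
    ⊑-tabulate = ⊑-reindex (cast (sym length-h)) (toℕ-cast (sym length-h)) (lookup-tabulate h)

    tabulate-⊑ : lookup (tabulate h) ⊑ h
    tabulate-⊑ = ⊑-reindex (cast length-h) (toℕ-cast length-h) (sym ∘ lookup-tabulate′)

  module _ {n m} {a : Vector ℕ n} {b : Vector ℕ m} (cay : IsCayleyᶠ a) (e : a ⊑ b) where

    open _⊑_ e renaming (map to f; increasing to inc; preserves to ord)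

    cayley-⊑-value≤ : ∀ i → a i ≤ b (f i)
    cayley-⊑-value≤ i = go (a i) i refl
      where
      go : ∀ v i → a i ≡ v → v ≤ b (f i)
      go zero    i _    = z≤n
      go (suc v) i ai≡1+v with cay i v (subst (v ≤_) (sym ai≡1+v) (n≤1+n v))
      ... | j , aj≡v = <-≤-trans (s≤s (go v j aj≡v))
                         (Equivalence.to (proj₁ (ord j i)) (subst₂ _<_ (sym aj≡v) (sym ai≡1+v) ≤-refl))

    cayley-⊑-inversion-bound : IsInversionᶠ b → ∀ i → a i + n ≤ m + toℕ i
    cayley-⊑-inversion-bound inv i = ≤-trans
      (+-monoˡ-≤ n (≤-trans (cayley-⊑-value≤ i) (inv (f i))))
      (increasing-room inc i)

  cayley-value<length : ∀ {n} {a : Vector ℕ n} → IsCayleyᶠ a → ∀ i → a i < n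
  cayley-value<length {a = a} cay i = injective⇒≤ {f = position} position-injective
    where
    position : Fin (suc (a i)) → Fin _
    position v = proj₁ (cay i (toℕ v) (≤-pred (toℕ<n v)))
    position-injective : Injective _≡_ _≡_ position
    position-injective {v} {w} eq = toℕ-injective (begin
      toℕ v            ≡⟨ proj₂ (cay i (toℕ v) _) ⟨
      a (position v)   ≡⟨ cong a eq ⟩
      a (position w)   ≡⟨ proj₂ (cay i (toℕ w) _) ⟩
      toℕ w            ∎)
      where open ≡-Reasoning

  -- squeeze v lowers every value above v by one, closing the gap left when v disappears.
  squeeze : ℕ → ℕ → ℕ
  squeeze v x with v <? x
  ... | yes _ = pred x
  ... | no  _ = x

  module _ {v : ℕ} where

    squeeze-≤ : ∀ x → squeeze v x ≤ x
    squeeze-≤ x with v <? x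
    ... | yes _ = pred[n]≤n
    ... | no  _ = ≤-refl

    squeeze-below : ∀ {x} → x ≤ v → squeeze v x ≡ x
    squeeze-below {x} x≤v with v <? x
    ... | yes v<x = contradiction v<x (≤⇒≯ x≤v)
    ... | no  _   = refl

    squeeze-above : ∀ {x} → v < x → squeeze v x ≡ pred x
    squeeze-above {x} v<x with v <? x
    ... | yes _   = refl
    ... | no  v≮x = contradiction v<x v≮x

    squeeze-increasing : ∀ {x y} → x ≢ v → y ≢ v → x < y → squeeze v x < squeeze v y
    squeeze-increasing {x} {y} x≢v y≢v x<y with v <? x | v <? y
    ... | yes v<x | yes _   = pred-mono-< ⦃ >-nonZero (≤-<-trans z≤n v<x) ⦄ x<y
    ... | yes v<x | no  v≮y = contradiction (<-trans v<x x<y) v≮y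
    ... | no  v≮x | yes v<y = <-≤-trans (≤∧≢⇒< (≮⇒≥ v≮x) x≢v) (<⇒≤pred v<y)
    ... | no  _   | no  _   = x<y

    squeeze-preimage : ∀ {w x} → v ≤ w → w ≤ squeeze v x → x ≢ v → suc w ≤ x
    squeeze-preimage {w} {x} v≤w w≤sx x≢v with v <? x
    ... | yes v<x = subst (suc w ≤_) (suc-pred x ⦃ >-nonZero (≤-<-trans z≤n v<x) ⦄) (s≤s w≤sx)
    ... | no  v≮x = contradiction (≤-antisym (≮⇒≥ v≮x) (≤-trans v≤w w≤sx)) x≢v

    squeeze-< : ∀ {x p} → x ≤ p → x ≢ v → v < p → squeeze v x < p
    squeeze-< {x} {p} x≤p x≢v v<p with v <? x
    ... | yes v<x = <-≤-trans (≤-reflexive (suc-pred x ⦃ >-nonZero (≤-<-trans z≤n v<x) ⦄)) x≤p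
    ... | no  v≮x = <-trans (≤∧≢⇒< (≮⇒≥ v≮x) x≢v) v<p

  toℕ-punchIn-< : ∀ {m} (k : Fin (suc m)) j → toℕ j < toℕ k → toℕ (punchIn k j) ≡ toℕ j
  toℕ-punchIn-< (suc k) zero    _         = refl
  toℕ-punchIn-< (suc k) (suc j) (s≤s j<k) = cong suc (toℕ-punchIn-< k j j<k)

  toℕ-punchIn-≥ : ∀ {m} (k : Fin (suc m)) j → toℕ k ≤ toℕ j → toℕ (punchIn k j) ≡ suc (toℕ j)
  toℕ-punchIn-≥ zero    j       _         = refl
  toℕ-punchIn-≥ (suc k) (suc j) (s≤s k≤j) = cong suc (toℕ-punchIn-≥ k j k≤j)

  module _ {m} {s : Vector ℕ (suc m)} {k : Fin (suc m)} where

    removeAt-inversion : (∀ p → toℕ p < toℕ k → s p ≤ toℕ p) →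
                         (∀ p → toℕ k < toℕ p → s p < toℕ p) → IsInversionᶠ (removeAt s k)
    removeAt-inversion before after j with toℕ j <? toℕ k
    ... | yes j<k = subst (s p ≤_) p≡j (before p (subst (_< toℕ k) (sym p≡j) j<k))
      where
      p = punchIn k j
      p≡j = toℕ-punchIn-< k j j<k
    ... | no  j≮k = ≤-pred (subst (s p <_) p≡1+j (after p (subst (toℕ k <_) (sym p≡1+j) (s≤s k≤j))))
      where
      p = punchIn k j
      k≤j = ≮⇒≥ j≮k
      p≡1+j = toℕ-punchIn-≥ k j k≤j

    removeAt-cayley : IsCayleyᶠ s → ∀ {q} → q ≢ k → s q ≡ s k → IsCayleyᶠ (removeAt s k)
    removeAt-cayley cay {q} q≢k sq≡sk j v v≤ with cay (punchIn k j) v v≤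
    ... | p , sp≡v with p ≟ᶠ k
    ...   | no  p≢k  = punchOut (p≢k ∘ sym) , trans (removeAt-punchOut s _) sp≡v
    ...   | yes refl = punchOut (q≢k ∘ sym) , trans (removeAt-punchOut s _) (trans sq≡sk sp≡v)

  module _ {m} {s : Vector ℕ (suc m)} {k : Fin (suc m)} (cay : IsCayleyᶠ s)
           (unique : ∀ q → q ≢ k → s q ≢ s k) where

    removeAt-cayley-except : ∀ j u → u ≤ removeAt s k j → u ≢ s k →
                             ∃ λ j′ → removeAt s k j′ ≡ u
    removeAt-cayley-except j u u≤ u≢v with cay (punchIn k j) u u≤
    ... | q , sq≡u = punchOut k≢q , trans (removeAt-punchOut s k≢q) sq≡u
      where
      k≢q : k ≢ q
      k≢q refl = u≢v (sym sq≡u)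

    squeeze-removeAt-cayley : IsCayleyᶠ (squeeze (s k) ∘ removeAt s k)
    squeeze-removeAt-cayley j w w≤ with w <? s k
    ... | yes w<v =
      let j′ , eq = removeAt-cayley-except j w (≤-trans w≤ (squeeze-≤ _)) (<⇒≢ w<v)
      in j′ , trans (cong (squeeze (s k)) eq) (squeeze-below (<⇒≤ w<v))
    ... | no  w≮v =
      let v≤w = ≮⇒≥ w≮v
          x≢v = unique (punchIn k j) (punchInᵢ≢i k j)
          j′ , eq = removeAt-cayley-except j (suc w) (squeeze-preimage v≤w w≤ x≢v)
                                                     (>⇒≢ (s≤s v≤w))
      in j′ , trans (cong (squeeze (s k)) eq) (squeeze-above (s≤s v≤w))

  minimal⇒no-shorter : ∀ {ρ σ m} {h : Vector ℕ m} → IsMinimal ρ σ →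
    IsInversionᶠ h → IsCayleyᶠ h → lookup ρ ⊑ h → h ⊑ lookup σ → length σ ≤ m
  minimal⇒no-shorter {ρ} {σ} {h = h} (_ , minimal) inv cay ρ⊑h h⊑σ =
    subst (_ ≤_) (length-tabulate h)
      (⊑⇒≤ (≼⇒⊑ {σ} {τ} (minimal τ τ∈IP (⊑⇒≼ {τ} {σ} (⊑-trans (tabulate-⊑ h) h⊑σ)))))
    where
    τ = tabulate h
    τ∈IP : InIP ρ τ
    τ∈IP = tabulate-inversion h inv , tabulate-cayley h cay , ⊑⇒≼ {ρ} {τ} (⊑-trans ρ⊑h (⊑-tabulate h))

  last-witness : ∀ {n} {P : Fin n → Set} → Decidable P → ∃ P →
                 ∃ λ t → P t × (∀ p → toℕ t < toℕ p → ¬ P p)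
  last-witness {suc n} P? (p , Pp) with any? (P? ∘ suc)
  last-witness P? _ | yes later =
    let t , Pt , last = last-witness (P? ∘ suc) later
    in suc t , Pt , λ { (suc q) (s≤s t<q) → last q t<q }
  last-witness P? (zero  , P0) | no ¬later = zero , P0 , λ { (suc q) _ Pq → ¬later (q , Pq) }
  last-witness P? (suc q , Pq) | no ¬later = ⊥-elim (¬later (q , Pq))

  encoding⇒≤ : ∀ {A B : Set} {a b} → A ↔ Fin a → B ↔ Fin b → (Code : A → B → Set) →
    (∀ x → ∃ (Code x)) → (∀ {x x′ c} → Code x c → Code x′ c → x ≡ x′) → a ≤ b
  encoding⇒≤ A↔ B↔ Code encode decode =
    injective⇒≤ {f = Inverse.to B↔ ∘ proj₁ ∘ encode ∘ Inverse.from A↔} λ eq →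
      Injection.injective (↔⇒↣ (↔-sym A↔))
        (decode (proj₂ (encode _))
                (subst (Code _) (sym (Injection.injective (↔⇒↣ B↔) eq)) (proj₂ (encode _))))

  ⊎↔+ : ∀ {a b} → (Fin a ⊎ Fin b) ↔ Fin (a + b)
  ⊎↔+ = ↔-sym +↔⊎

  ⊎³↔+ : ∀ {a b c} → (Fin a ⊎ (Fin b ⊎ Fin c)) ↔ Fin (a + (b + c))
  ⊎³↔+ = ↔-trans (↔-refl ⊎-↔ ⊎↔+) ⊎↔+

  module Counting {n m} {r : Vector ℕ n} {s : Vector ℕ (suc m)}
    (inv : IsInversionᶠ s) (cay : IsCayleyᶠ s) (e : r ⊑ s)
    (repeated : ∀ p → ¬ Covered (_⊑_.map e) p → ∃ λ q → q ≢ p × s q ≡ s p)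
    (tight-after : ∀ p → ¬ Covered (_⊑_.map e) p → ∃ λ p′ → toℕ p < toℕ p′ × IsTight s p′)
    where

    open _⊑_ e renaming (map to f; increasing to inc; preserves to ord)

    private
      last-tight = last-witness (λ p → s p ≟ toℕ p) (zero , n≤0⇒n≡0 (inv zero))
      t = proj₁ last-tight
      T = toℕ t
      t-tight : s t ≡ T
      t-tight = proj₁ (proj₂ last-tight)

    uncovered<T : ∀ p → ¬ Covered f p → toℕ p < T
    uncovered<T p unc with tight-after p unc
    ... | p′ , p<p′ , p′-tight with <-cmp T (toℕ p′)
    ...   | tri< t<p′ _ _ = contradiction p′-tight (proj₂ (proj₂ last-tight) p′ t<p′)
    ...   | tri≈ _ t≡p′ _ = subst (toℕ p <_) (sym t≡p′) p<p′
    ...   | tri> _ _ p′<t = <-trans p<p′ p′<t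

    covered? : ∀ p → Dec (Covered f p)
    covered? p = any? (λ j → f j ≟ᶠ p)

    private
      t-covered : Covered f t
      t-covered with covered? t
      ... | yes cov = cov
      ... | no  unc = contradiction (uncovered<T t unc) (<-irrefl refl)
      i₀ = proj₁ t-covered
      I = toℕ i₀
      R = r i₀
      fi₀≡t : f i₀ ≡ t
      fi₀≡t = proj₂ t-covered

      prefix : Fin I → Fin n
      prefix a = Fin.inject≤ a (<⇒≤ (toℕ<n i₀))

      prefix<T : ∀ a → toℕ (f (prefix a)) < T
      prefix<T a = subst (toℕ (f (prefix a)) <_) (cong toℕ fi₀≡t)
        (inc (prefix a) i₀ (subst (_< I) (sym (toℕ-inject≤ a _)) (toℕ<n a)))

      prefix-injective : ∀ {a a′} → f (prefix a) ≡ f (prefix a′) → a ≡ a′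
      prefix-injective eq = inject≤-injective _ _ _ _ (increasing⇒injective inc eq)

    data PositionCode : Fin (suc m) ⊎ Fin I → Fin n ⊎ Fin T → Set where
      covered   : ∀ {p} j → f j ≡ p → PositionCode (inj₁ p) (inj₁ j)
      uncovered : ∀ {p c} → ¬ Covered f p → toℕ c ≡ toℕ p → PositionCode (inj₁ p) (inj₂ c)
      before-t  : ∀ {a c} → toℕ c ≡ toℕ (f (prefix a)) → PositionCode (inj₂ a) (inj₂ c)

    positionCode : ∀ x → ∃ (PositionCode x)
    positionCode (inj₁ p) with covered? p
    ... | yes (j , fj≡p) = inj₁ j , covered j fj≡p
    ... | no  unc        = inj₂ (fromℕ< (uncovered<T p unc)) , uncovered unc (toℕ-fromℕ< _)
    positionCode (inj₂ a) = inj₂ (fromℕ< (prefix<T a)) , before-t (toℕ-fromℕ< _)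

    positionCode-unique : ∀ {x x′ c} → PositionCode x c → PositionCode x′ c → x ≡ x′
    positionCode-unique (covered j refl)   (covered .j refl) = refl
    positionCode-unique (uncovered _ c≡p)  (uncovered _ c≡p′) =
      cong inj₁ (toℕ-injective (trans (sym c≡p) c≡p′))
    positionCode-unique (uncovered unc c≡p) (before-t {a} c≡fa) =
      contradiction (prefix a , toℕ-injective (trans (sym c≡fa) c≡p)) unc
    positionCode-unique (before-t {a} c≡fa) (uncovered unc c≡p) =
      contradiction (prefix a , toℕ-injective (trans (sym c≡fa) c≡p)) unc
    positionCode-unique (before-t c≡fa)    (before-t c≡fa′) =
      cong inj₂ (prefix-injective (toℕ-injective (trans (sym c≡fa) c≡fa′)))

    positions-bound : suc m + I ≤ n + T
    positions-bound = encoding⇒≤ ⊎↔+ ⊎↔+ PositionCode positionCode positionCode-unique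

    PatternValue : Fin T → Set
    PatternValue w = ∃ λ j → s (f j) ≡ toℕ w

    private
      occurrence-of : ∀ (w : Fin T) → ∃ λ p → s p ≡ toℕ w
      occurrence-of w = cay t (toℕ w) (subst (toℕ w ≤_) (sym t-tight) (<⇒≤ (toℕ<n w)))
      occurrence = proj₁ ∘ occurrence-of

      nonpattern-uncovered : ∀ {w p} → ¬ PatternValue w → s p ≡ toℕ w → ¬ Covered f p
      nonpattern-uncovered npv sp≡w (j , refl) = npv (j , sp≡w)

      repetition : ∀ w → ¬ PatternValue w → ∃ λ q → q ≢ occurrence w × s q ≡ s (occurrence w)
      repetition w npv = repeated (occurrence w) (nonpattern-uncovered npv (proj₂ (occurrence-of w)))
      second-occurrence : ∀ w → ¬ PatternValue w → Fin (suc m)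
      second-occurrence w npv = proj₁ (repetition w npv)
      s-second : ∀ w npv → s (second-occurrence w npv) ≡ toℕ w
      s-second w npv = trans (proj₂ (proj₂ (repetition w npv))) (proj₂ (occurrence-of w))

      pattern-value<R : ∀ {w : Fin T} j → s (f j) ≡ toℕ w → r j < R
      pattern-value<R {w} j sfj≡w = Equivalence.from (proj₁ (ord j i₀))
        (subst₂ _<_ (sym sfj≡w) (sym (trans (cong s fi₀≡t) t-tight)) (toℕ<n w))

      same-value : ∀ {p p′ : Fin (suc m)} {w w′ : Fin T} →
                   toℕ p ≡ toℕ p′ → s p ≡ toℕ w → s p′ ≡ toℕ w′ → w ≡ w′
      same-value p≡p′ sp≡w sp′≡w′ =
        toℕ-injective (trans (sym sp≡w) (trans (cong s (toℕ-injective p≡p′)) sp′≡w′))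

      same-pattern-value : ∀ {j j′} {w w′ : Fin T} →
                           s (f j) ≡ toℕ w → s (f j′) ≡ toℕ w′ → r j ≡ r j′ → w ≡ w′
      same-pattern-value {j} {j′} sfj≡w sfj′≡w′ rj≡rj′ =
        toℕ-injective (trans (sym sfj≡w) (trans (Equivalence.to (proj₂ (ord j j′)) rj≡rj′) sfj′≡w′))

      first≢second : ∀ {w w′} {c : Fin T} npv′ →
                     toℕ c ≡ toℕ (occurrence w) → toℕ c ≡ toℕ (second-occurrence w′ npv′) → ⊥
      first≢second {w} {w′} npv′ c≡p c≡q = proj₁ (proj₂ (repetition w′ npv′))
        (toℕ-injective (trans (trans (sym c≡q) c≡p) (cong (toℕ ∘ occurrence) w≡w′)))
        where w≡w′ = same-value (trans (sym c≡p) c≡q) (proj₂ (occurrence-of w)) (s-second w′ npv′)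

    -- Each value w below T is coded twice: by the value of ρ behind it when w is a pattern value,
    -- and otherwise by two distinct uncovered positions carrying w.
    data ValueCode : Fin T ⊎ (Fin T ⊎ Fin I) → Fin R ⊎ (Fin R ⊎ Fin T) → Set where
      pattern₁ : ∀ {w y} j → s (f j) ≡ toℕ w → toℕ y ≡ r j → ValueCode (inj₁ w) (inj₁ y)
      pattern₂ : ∀ {w y} j → s (f j) ≡ toℕ w → toℕ y ≡ r j →
                 ValueCode (inj₂ (inj₁ w)) (inj₂ (inj₁ y))
      first    : ∀ {w c} → ¬ PatternValue w → toℕ c ≡ toℕ (occurrence w) →
                 ValueCode (inj₁ w) (inj₂ (inj₂ c))
      second   : ∀ {w c} (npv : ¬ PatternValue w) → toℕ c ≡ toℕ (second-occurrence w npv) →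
                 ValueCode (inj₂ (inj₁ w)) (inj₂ (inj₂ c))
      before-t : ∀ {a c} → toℕ c ≡ toℕ (f (prefix a)) → ValueCode (inj₂ (inj₂ a)) (inj₂ (inj₂ c))

    valueCode : ∀ x → ∃ (ValueCode x)
    valueCode (inj₁ w) with any? (λ j → s (f j) ≟ toℕ w)
    ... | yes (j , sfj≡w) = inj₁ (fromℕ< (pattern-value<R j sfj≡w)) , pattern₁ j sfj≡w (toℕ-fromℕ< _)
    ... | no  npv = inj₂ (inj₂ (fromℕ< (uncovered<T _ (nonpattern-uncovered npv (proj₂ (occurrence-of w)))))) ,
                    first npv (toℕ-fromℕ< _)
    valueCode (inj₂ (inj₁ w)) with any? (λ j → s (f j) ≟ toℕ w)
    ... | yes (j , sfj≡w) =
      inj₂ (inj₁ (fromℕ< (pattern-value<R j sfj≡w))) , pattern₂ j sfj≡w (toℕ-fromℕ< _)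
    ... | no  npv = inj₂ (inj₂ (fromℕ< (uncovered<T _ (nonpattern-uncovered npv (s-second w npv))))) ,
                    second npv (toℕ-fromℕ< _)
    valueCode (inj₂ (inj₂ a)) = inj₂ (inj₂ (fromℕ< (prefix<T a))) , before-t (toℕ-fromℕ< _)

    valueCode-unique : ∀ {x x′ c} → ValueCode x c → ValueCode x′ c → x ≡ x′
    valueCode-unique (pattern₁ j sfj≡w y≡rj) (pattern₁ j′ sfj′≡w′ y≡rj′) =
      cong inj₁ (same-pattern-value sfj≡w sfj′≡w′ (trans (sym y≡rj) y≡rj′))
    valueCode-unique (pattern₂ j sfj≡w y≡rj) (pattern₂ j′ sfj′≡w′ y≡rj′) =
      cong (inj₂ ∘ inj₁) (same-pattern-value sfj≡w sfj′≡w′ (trans (sym y≡rj) y≡rj′))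
    valueCode-unique (first {w} _ c≡p) (first {w′} _ c≡p′) =
      cong inj₁ (same-value (trans (sym c≡p) c≡p′) (proj₂ (occurrence-of w)) (proj₂ (occurrence-of w′)))
    valueCode-unique (first _ c≡p) (second npv′ c≡q) = ⊥-elim (first≢second npv′ c≡p c≡q)
    valueCode-unique (second npv c≡q) (first _ c≡p) = ⊥-elim (first≢second npv c≡p c≡q)
    valueCode-unique (second {w} npv c≡q) (second {w′} npv′ c≡q′) =
      cong (inj₂ ∘ inj₁) (same-value (trans (sym c≡q) c≡q′) (s-second w npv) (s-second w′ npv′))
    valueCode-unique (first {w} npv c≡p) (before-t {a} c≡fa) =
      ⊥-elim $ nonpattern-uncovered npv (proj₂ (occurrence-of w)) (prefix a , toℕ-injective (trans (sym c≡fa) c≡p))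
    valueCode-unique (before-t {a} c≡fa) (first {w} npv c≡p) =
      ⊥-elim $ nonpattern-uncovered npv (proj₂ (occurrence-of w)) (prefix a , toℕ-injective (trans (sym c≡fa) c≡p))
    valueCode-unique (second {w} npv c≡q) (before-t {a} c≡fa) =
      ⊥-elim $ nonpattern-uncovered npv (s-second w npv) (prefix a , toℕ-injective (trans (sym c≡fa) c≡q))
    valueCode-unique (before-t {a} c≡fa) (second {w} npv c≡q) =
      ⊥-elim $ nonpattern-uncovered npv (s-second w npv) (prefix a , toℕ-injective (trans (sym c≡fa) c≡q))
    valueCode-unique (before-t c≡fa) (before-t c≡fa′) =
      cong (inj₂ ∘ inj₂) (prefix-injective (toℕ-injective (trans (sym c≡fa) c≡fa′)))

    values-bound : T + I ≤ R + R
    values-bound = +-cancelˡ-≤ T _ _ (begin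
      T + (T + I) ≤⟨ encoding⇒≤ ⊎³↔+ ⊎³↔+ ValueCode valueCode valueCode-unique ⟩
      R + (R + T) ≡⟨ +-assoc R R T ⟨
      R + R + T   ≡⟨ +-comm (R + R) T ⟩
      T + (R + R) ∎)
      where open ≤-Reasoning

    length-bound : suc m + (I + I) ≤ n + (R + R)
    length-bound = begin
      suc m + (I + I) ≡⟨ +-assoc (suc m) I I ⟨
      suc m + I + I   ≤⟨ +-monoˡ-≤ I positions-bound ⟩
      n + T + I       ≡⟨ +-assoc n T I ⟩
      n + (T + I)     ≤⟨ +-monoʳ-≤ n values-bound ⟩
      n + (R + R)     ∎
      where open ≤-Reasoning

    upper-bound : ∃ λ i → suc m + (toℕ i + toℕ i) ≤ n + (r i + r i)
    upper-bound = i₀ , length-bound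

  module Minimal {ρ y ys} (minimal : IsMinimal ρ (y ∷ ys)) where

    private
      s = lookup (y ∷ ys)
      inv : IsInversionᶠ s
      inv = proj₁ (proj₁ minimal)
      cay : IsCayleyᶠ s
      cay = lookup-cayley (proj₁ (proj₂ (proj₁ minimal)))
      e : lookup ρ ⊑ s
      e = ≼⇒⊑ {ρ} {y ∷ ys} (proj₂ (proj₂ (proj₁ minimal)))
      f = _⊑_.map e

      no-shorter : {h : Vector ℕ (length ys)} →
                   IsInversionᶠ h → IsCayleyᶠ h → lookup ρ ⊑ h → h ⊑ s → ⊥
      no-shorter inv cay ρ⊑h h⊑s = 1+n≰n (minimal⇒no-shorter {ρ} minimal inv cay ρ⊑h h⊑s)

    -- Deleting an uncovered position k (and squeezing out σ_k if it occurs only there) would give an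
    -- element of IP[ρ] below σ and shorter than σ.
    uncovered-repeated : ∀ k → ¬ Covered f k → ∃ λ q → q ≢ k × s q ≡ s k
    uncovered-repeated k unc with any? (λ q → ¬? (q ≟ᶠ k) ×-dec (s q ≟ s k))
    ... | yes rep = rep
    ... | no ¬rep = ⊥-elim (no-shorter
      (removeAt-inversion (λ p _ → ≤-trans (squeeze-≤ (s p)) (inv p))
                          (λ p k<p → squeeze-< (inv p) (unique p (k≢p k<p ∘ sym)) (≤-<-trans (inv k) k<p)))
      (squeeze-removeAt-cayley cay unique)
      (⊑-trans (⊑-removeAt e unc) (⊑-relabel (squeeze v) squeeze-mono))
      (⊑-trans (relabel-⊑ (squeeze v) squeeze-mono) (removeAt-⊑ s k)))
      where
      v = s k
      unique : ∀ q → q ≢ k → s q ≢ v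
      unique q q≢k sq≡v = ¬rep (q , q≢k , sq≡v)
      k≢p : ∀ {p} → toℕ k < toℕ p → k ≢ p
      k≢p k<p refl = <-irrefl refl k<p
      squeeze-mono : ∀ i j → removeAt s k i < removeAt s k j →
                     squeeze v (removeAt s k i) < squeeze v (removeAt s k j)
      squeeze-mono i j = squeeze-increasing (unique _ (punchInᵢ≢i k i)) (unique _ (punchInᵢ≢i k j))

    uncovered-tight-after : ∀ k → ¬ Covered f k → ∃ λ p → toℕ k < toℕ p × IsTight s p
    uncovered-tight-after k unc with any? (λ p → (toℕ k <? toℕ p) ×-dec (s p ≟ toℕ p))
    ... | yes tight = tight
    ... | no ¬tight = ⊥-elim (no-shorter
      (removeAt-inversion (λ p _ → inv p)
                          (λ p k<p → ≤∧≢⇒< (inv p) (λ tight → ¬tight (p , k<p , tight))))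
      (removeAt-cayley cay q≢k sq≡sk)
      (⊑-removeAt e unc)
      (removeAt-⊑ s k))
      where
      q≢k = proj₁ (proj₂ (uncovered-repeated k unc))
      sq≡sk = proj₂ (proj₂ (uncovered-repeated k unc))

    lower-bound : IsCayleyᶠ (lookup ρ) → ∀ i → lookup ρ i + length ρ ≤ length (y ∷ ys) + toℕ i
    lower-bound cay-ρ = cayley-⊑-inversion-bound cay-ρ e inv

    upper-bound : ∃ λ i → length (y ∷ ys) + (toℕ i + toℕ i) ≤ length ρ + (lookup ρ i + lookup ρ i)
    upper-bound = Counting.upper-bound inv cay e uncovered-repeated uncovered-tight-after

open Sequences

open import Data.Empty using (⊥-elim)
open import Data.Fin using (Fin; zero; suc; toℕ)
open import Data.Integer using (+_; _+_; _*_; _≤_; _-_; +≤+; -_)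
open import Data.Integer.Properties
  using (≤-refl; ≤-trans; i≤i⊔j; i≤j⊔i; ⊔-sel; +-monoʳ-≤; +-monoˡ-≤; *-monoˡ-≤-nonNeg; module ≤-Reasoning)
open import Data.Integer.Solver using (module +-*-Solver)
open import Data.List using (lookup)
import Data.Nat as ℕ
import Data.Nat.Properties as ℕ
open import Data.Product using (∃; _,_; proj₁; proj₂)
open import Data.Sum using (inj₁; inj₂)
open import Relation.Binary.PropositionalEquality using (_≡_; refl; sym; trans; cong; subst)

m+n≤o+p⇒m-p≤o-n : ∀ {m n o p} → m ℕ.+ n ℕ.≤ o ℕ.+ p → + m - + p ≤ + o - + n
m+n≤o+p⇒m-p≤o-n {m} {n} {o} {p} m+n≤o+p = begin
  + m - + p                  ≡⟨ solve 3 (λ m n p → m :- p := (m :+ n) :- (n :+ p)) refl (+ m) (+ n) (+ p) ⟩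
  (+ m + + n) - (+ n + + p)  ≤⟨ +-monoˡ-≤ (- (+ n + + p)) (+≤+ m+n≤o+p) ⟩
  (+ o + + p) - (+ n + + p)  ≡⟨ solve 3 (λ o n p → (o :+ p) :- (n :+ p) := o :- n) refl (+ o) (+ n) (+ p) ⟩
  + o - + n                  ∎
  where
  open ≤-Reasoning
  open +-*-Solver

mddFrom-≥ : ∀ pos x xs (k : Fin (length (x ∷ xs))) →
  + lookup (x ∷ xs) k - + (pos ℕ.+ toℕ k) + + 1 ≤ mddFrom pos x xs
mddFrom-≥ pos x []       zero    rewrite ℕ.+-identityʳ pos = ≤-refl
mddFrom-≥ pos x (y ∷ ys) zero    rewrite ℕ.+-identityʳ pos = i≤i⊔j _ _
mddFrom-≥ pos x (y ∷ ys) (suc k) rewrite ℕ.+-suc pos (toℕ k) =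
  ≤-trans (mddFrom-≥ (ℕ.suc pos) y ys k) (i≤j⊔i _ _)

mddFrom-attained : ∀ pos x xs →
  ∃ λ (k : Fin (length (x ∷ xs))) → mddFrom pos x xs ≡ + lookup (x ∷ xs) k - + (pos ℕ.+ toℕ k) + + 1
mddFrom-attained pos x [] = zero , cong (λ i → + x - + i + + 1) (sym (ℕ.+-identityʳ pos))
mddFrom-attained pos x (y ∷ ys) with ⊔-sel (+ x - + pos + + 1) (mddFrom (ℕ.suc pos) y ys)
... | inj₁ head-max = zero , trans head-max (cong (λ i → + x - + i + + 1) (sym (ℕ.+-identityʳ pos)))
... | inj₂ tail-max =
  let k , attained = mddFrom-attained (ℕ.suc pos) y ys
  in suc k , trans tail-max
       (trans attained (cong (λ i → + lookup (y ∷ ys) k - + i + + 1) (sym (ℕ.+-suc pos (toℕ k)))))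

v-[1+i]+1≡v-i : ∀ v i → + v - + ℕ.suc i + + 1 ≡ + v - + i
v-[1+i]+1≡v-i v i = solve 2 (λ v i → v :- (con (+ 1) :+ i) :+ con (+ 1) := v :- i) refl (+ v) (+ i)
  where open +-*-Solver

mdd-≥ : ∀ x xs (k : Fin (length (x ∷ xs))) → + lookup (x ∷ xs) k - + toℕ k ≤ mdd (x ∷ xs)
mdd-≥ x xs k = subst (_≤ mdd (x ∷ xs)) (v-[1+i]+1≡v-i (lookup (x ∷ xs) k) (toℕ k)) (mddFrom-≥ 1 x xs k)

mdd-attained : ∀ x xs → ∃ λ (k : Fin (length (x ∷ xs))) → mdd (x ∷ xs) ≡ + lookup (x ∷ xs) k - + toℕ k
mdd-attained x xs =
  let k , attained = mddFrom-attained 1 x xs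
  in k , trans attained (v-[1+i]+1≡v-i (lookup (x ∷ xs) k) (toℕ k))

r+n≤L+i⇒n+[r-i]≤L : ∀ {n r i L} → r ℕ.+ n ℕ.≤ L ℕ.+ i → + n + (+ r - + i) ≤ + L
r+n≤L+i⇒n+[r-i]≤L {n} {r} {i} {L} bound = begin
  + n + (+ r - + i)  ≤⟨ +-monoʳ-≤ (+ n) (m+n≤o+p⇒m-p≤o-n {r} {n} {L} {i} bound) ⟩
  + n + (+ L - + n)  ≡⟨ solve 2 (λ n L → n :+ (L :- n) := L) refl (+ n) (+ L) ⟩
  + L                ∎
  where
  open ≤-Reasoning
  open +-*-Solver

L+2i≤n+2r⇒L≤n+2[r-i] : ∀ {n r i L} → L ℕ.+ (i ℕ.+ i) ℕ.≤ n ℕ.+ (r ℕ.+ r) →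
                       + L ≤ + n + + 2 * (+ r - + i)
L+2i≤n+2r⇒L≤n+2[r-i] {n} {r} {i} {L} bound = begin
  + L                                ≡⟨ solve 1 (λ L → L := L :- con (+ 0)) refl (+ L) ⟩
  + L - + 0                          ≤⟨ m+n≤o+p⇒m-p≤o-n {L} {i ℕ.+ i} {n ℕ.+ (r ℕ.+ r)} {0} bound′ ⟩
  + (n ℕ.+ (r ℕ.+ r)) - + (i ℕ.+ i)  ≡⟨ solve 3 (λ n r i → (n :+ (r :+ r)) :- (i :+ i) := n :+ con (+ 2) :* (r :- i))
                                              refl (+ n) (+ r) (+ i) ⟩
  + n + + 2 * (+ r - + i)            ∎
  where
  open ≤-Reasoning
  open +-*-Solver
  bound′ : L ℕ.+ (i ℕ.+ i) ℕ.≤ n ℕ.+ (r ℕ.+ r) ℕ.+ 0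
  bound′ = ℕ.≤-trans bound (ℕ.≤-reflexive (sym (ℕ.+-identityʳ _)))

r<n⇒n+2[r-i]≤3n-2 : ∀ {n r i} → r ℕ.< n → + n + + 2 * (+ r - + i) ≤ + 3 * + n - + 2
r<n⇒n+2[r-i]≤3n-2 {n} {r} {i} r<n = begin
  + n + + 2 * (+ r - + i)  ≤⟨ +-monoʳ-≤ (+ n) (*-monoˡ-≤-nonNeg (+ 2) (m+n≤o+p⇒m-p≤o-n {r} {1} {n} {i} r+1≤n+i)) ⟩
  + n + + 2 * (+ n - + 1)  ≡⟨ solve 1 (λ n → n :+ con (+ 2) :* (n :- con (+ 1)) := con (+ 3) :* n :- con (+ 2))
                                    refl (+ n) ⟩
  + 3 * + n - + 2          ∎
  where
  open ≤-Reasoning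
  open +-*-Solver
  r+1≤n+i : r ℕ.+ 1 ℕ.≤ n ℕ.+ i
  r+1≤n+i = ℕ.≤-trans (ℕ.≤-reflexive (ℕ.+-comm r 1)) (ℕ.≤-trans r<n (ℕ.m≤m+n n i))

corollary3p4 : (ρ σ : List ℕ) → ρ ≢ [] → IsCayley ρ → IsMinimal ρ σ →
    ((+ length ρ + mdd ρ ≤ + length σ) × (+ length σ ≤ + length ρ + + 2 * mdd ρ))
      × (+ length σ ≤ + 3 * + length ρ - + 2)
corollary3p4 []       _        ρ≢[] _ _ = ⊥-elim (ρ≢[] refl)
corollary3p4 (x ∷ xs) []       _ _ ((_ , _ , f , _) , _) with f zero
... | ()
corollary3p4 (x ∷ xs) (y ∷ ys) _ cay-ρ minimal = (lower , upper) , at-most-3n-2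
  where
  open Minimal minimal using (lower-bound; upper-bound)
  n = length (x ∷ xs)
  k : Fin n
  k = proj₁ (mdd-attained x xs)
  mdd≡excess : mdd (x ∷ xs) ≡ + lookup (x ∷ xs) k - + toℕ k
  mdd≡excess = proj₂ (mdd-attained x xs)
  i : Fin n
  i = proj₁ upper-bound
  lower : + n + mdd (x ∷ xs) ≤ + length (y ∷ ys)
  lower = subst (λ d → + n + d ≤ + length (y ∷ ys)) (sym mdd≡excess)
    (r+n≤L+i⇒n+[r-i]≤L {r = lookup (x ∷ xs) k} {i = toℕ k} (lower-bound (lookup-cayley cay-ρ) k))
  upper : + length (y ∷ ys) ≤ + n + + 2 * mdd (x ∷ xs)
  upper = ≤-trans (L+2i≤n+2r⇒L≤n+2[r-i] {r = lookup (x ∷ xs) i} {i = toℕ i} (proj₂ upper-bound))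
    (+-monoʳ-≤ (+ n) (*-monoˡ-≤-nonNeg (+ 2) (mdd-≥ x xs i)))
  at-most-3n-2 : + length (y ∷ ys) ≤ + 3 * + n - + 2
  at-most-3n-2 = ≤-trans upper (subst (λ d → + n + + 2 * d ≤ + 3 * + n - + 2) (sym mdd≡excess)
    (r<n⇒n+2[r-i]≤3n-2 {i = toℕ k} (cayley-value<length (lookup-cayley cay-ρ) k)))
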